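{- Let $1\leq i\leq N$ and $\mathbf z=(z_1,\ldots,z_N)\in\mathcal V_i$. If there exists $2\leq j\leq i$ such that $z_\ell=0$ for all $\ell\notin\{j-1,j\}$, then $\mathbf z=\mathbf x_i(j+1)$. In particular, $\mathbf z\in\mathcal S_i$.
   Context: $(h_k)_{k\geq0}$ is the Fibonacci sequence, $h_0=0$, $h_1=1$, $h_{k+1}=h_k+h_{k-1}$. Let $A$ be the $2\times N$ matrix with rows $(h_1,\ldots,h_N)$ and $(h_0,\ldots,h_{N-1})$; for $1\leq n\leq N$, $\mathcal V_n=\{\mathbf x\in\mathbb Z_{\geq0}^N:A\mathbf x=(h_n,h_{n-1})^T\}$. For $2\leq n\leq N$ and $3\leq k\leq n+1$, $\mathbf x_n(k)\in\mathbb R^N$ has entry $h_{n+1-k}$ in position $k-2$, entry $h_{n+2-k}$ in position $k-1$, and $0$ elsewhere; $\mathcal S_n=\{\mathbf x_n(k):3\leq k\leq n+1\}$. -}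

module Defs where

open import Data.Nat using (ℕ; zero; suc; _+_; _*_; _∸_; _≤_; _≟_)
open import Data.Fin using (Fin; toℕ)
open import Data.Product using (Σ; _×_; ∃-syntax)
open import Relation.Binary.PropositionalEquality using (_≡_)
open import Relation.Nullary using (yes; no)

h : ℕ → ℕ
h zero = 0
h (suc zero) = 1
h (suc (suc k)) = h (suc k) + h k

-- Vectors in Z_{≥0}^N / R^N (here all relevant ones are ℕ-valued) as functions Fin N → ℕ.
-- Convention: the 1-based position p of the paper is the Fin index q with toℕ q + 1 = p.

sumFin : ∀ {N} → (Fin N → ℕ) → ℕ
sumFin {zero} f = 0
sumFin {suc N} f = f Fin.zero + sumFin {N} (λ q → f (Fin.suc q))

-- first row of A x : Σ_p h_p x_p ;  second row : Σ_p h_{p-1} x_p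
row₁ : ∀ {N} → (Fin N → ℕ) → ℕ
row₁ x = sumFin (λ q → h (suc (toℕ q)) * x q)

row₂ : ∀ {N} → (Fin N → ℕ) → ℕ
row₂ x = sumFin (λ q → h (toℕ q) * x q)

InV : ∀ {N} → ℕ → (Fin N → ℕ) → Set
InV n x = (row₁ x ≡ h n) × (row₂ x ≡ h (n ∸ 1))

-- x_n(k): entry h_{n+1-k} at position k-2, h_{n+2-k} at position k-1, 0 elsewhere
xvec : ∀ {N} → ℕ → ℕ → Fin N → ℕ
xvec n k q with toℕ q + 3 ≟ k
... | yes _ = h ((n + 1) ∸ k)
... | no _ with toℕ q + 2 ≟ k
...   | yes _ = h ((n + 2) ∸ k)
...   | no _ = 0

InS : ∀ {N} → ℕ → (Fin N → ℕ) → Set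
InS {N} n x = ∃[ k ] (3 ≤ k × k ≤ n + 1 × (∀ q → x q ≡ xvec {N} n k q))

{-# OPTIONS --safe #-}

-- If z is supported on the positions j-1, j with values a, b, the two rows of A z are
-- F (j-2) and F (j-1) for F c = h c * a + h (c+1) * b.  Both F and c ↦ h (c + 1 + e),
-- where i = j + e, satisfy the Fibonacci recurrence and agree at j-2 and j-1; running the
-- recurrence backwards they agree at 0 and 1, which gives b = h (e+1) and a + b = h (e+2),
-- i.e. z = x_i(j+1).

module Submission where

open import Defs
open import Data.Nat using (ℕ; zero; suc; _+_; _*_; _∸_; _≤_; _<_; _≟_; s≤s)
open import Data.Nat.Properties
open import Data.Nat.Solver using (module +-*-Solver)
open import Data.Fin using (Fin; toℕ; fromℕ<) renaming (_≟_ to _≟ᶠ_)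
open import Data.Fin.Properties using (toℕ-injective; toℕ-fromℕ<) renaming (suc-injective to Fin-suc-injective)
open import Data.Product using (_×_; _,_; proj₁; proj₂)
open import Relation.Binary.PropositionalEquality
open import Relation.Nullary using (yes; no; contradiction)
open import Function using (_∘_)

open +-*-Solver using (solve; _:=_; _:+_; _:*_)

sumFin-zero : ∀ {N} (f : Fin N → ℕ) → (∀ q → f q ≡ 0) → sumFin f ≡ 0
sumFin-zero {zero}  f f≡0 = refl
sumFin-zero {suc N} f f≡0 =
  cong₂ _+_ (f≡0 Fin.zero) (sumFin-zero (λ q → f (Fin.suc q)) (λ q → f≡0 (Fin.suc q)))

sumFin-single : ∀ {N} (f : Fin N → ℕ) (q₀ : Fin N) →
  (∀ q → q ≢ q₀ → f q ≡ 0) → sumFin f ≡ f q₀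
sumFin-single f Fin.zero f≡0 =
  trans (cong (f Fin.zero +_) (sumFin-zero _ (λ q → f≡0 (Fin.suc q) λ ())))
        (+-identityʳ (f Fin.zero))
sumFin-single f (Fin.suc q₀) f≡0 =
  cong₂ _+_ (f≡0 Fin.zero λ ())
        (sumFin-single (λ q → f (Fin.suc q)) q₀
          (λ q q≢q₀ → f≡0 (Fin.suc q) (q≢q₀ ∘ Fin-suc-injective)))

sumFin-pair : ∀ {N} (f : Fin N → ℕ) (q₁ q₂ : Fin N) → q₁ ≢ q₂ →
  (∀ q → q ≢ q₁ → q ≢ q₂ → f q ≡ 0) → sumFin f ≡ f q₁ + f q₂
sumFin-pair f Fin.zero Fin.zero q₁≢q₂ f≡0 = contradiction refl q₁≢q₂
sumFin-pair f Fin.zero (Fin.suc q₂) q₁≢q₂ f≡0 =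
  cong (f Fin.zero +_)
    (sumFin-single (λ q → f (Fin.suc q)) q₂
      (λ q q≢q₂ → f≡0 (Fin.suc q) (λ ()) (q≢q₂ ∘ Fin-suc-injective)))
sumFin-pair f (Fin.suc q₁) Fin.zero q₁≢q₂ f≡0 =
  trans (cong (f Fin.zero +_)
          (sumFin-single (λ q → f (Fin.suc q)) q₁
            (λ q q≢q₁ → f≡0 (Fin.suc q) (q≢q₁ ∘ Fin-suc-injective) (λ ()))))
        (+-comm (f Fin.zero) (f (Fin.suc q₁)))
sumFin-pair f (Fin.suc q₁) (Fin.suc q₂) q₁≢q₂ f≡0 =
  cong₂ _+_ (f≡0 Fin.zero (λ ()) (λ ()))
    (sumFin-pair (λ q → f (Fin.suc q)) q₁ q₂ (q₁≢q₂ ∘ cong Fin.suc)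
      (λ q q≢q₁ q≢q₂ → f≡0 (Fin.suc q) (q≢q₁ ∘ Fin-suc-injective) (q≢q₂ ∘ Fin-suc-injective)))

sumFin-weighted-pair : ∀ {N} (w f : Fin N → ℕ) (q₁ q₂ : Fin N) → q₁ ≢ q₂ →
  (∀ q → q ≢ q₁ → q ≢ q₂ → f q ≡ 0) →
  sumFin (λ q → w q * f q) ≡ w q₁ * f q₁ + w q₂ * f q₂
sumFin-weighted-pair w f q₁ q₂ q₁≢q₂ f≡0 =
  sumFin-pair (λ q → w q * f q) q₁ q₂ q₁≢q₂
    (λ q q≢q₁ q≢q₂ → trans (cong (w q *_) (f≡0 q q≢q₁ q≢q₂)) (*-zeroʳ (w q)))

FibonacciRecurrence : (ℕ → ℕ) → Set
FibonacciRecurrence f = ∀ c → f (suc (suc c)) ≡ f (suc c) + f c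

h-recurrence : FibonacciRecurrence h
h-recurrence c = refl

recurrence-suc : ∀ {f} → FibonacciRecurrence f → FibonacciRecurrence (f ∘ suc)
recurrence-suc rec = rec ∘ suc

recurrence-shift : ∀ {f} → FibonacciRecurrence f → ∀ d → FibonacciRecurrence (λ c → f (c + d))
recurrence-shift rec d c = rec (c + d)

recurrence-linear : ∀ {f g} → FibonacciRecurrence f → FibonacciRecurrence g →
  ∀ a b → FibonacciRecurrence (λ c → f c * a + g c * b)
recurrence-linear {f} {g} recf recg a b c
  rewrite recf c | recg c = regroup (f (suc c)) (f c) (g (suc c)) (g c) a b
  where
  regroup : ∀ x y u v a b → (x + y) * a + (u + v) * b ≡ (x * a + u * b) + (y * a + v * b)
  regroup = solve 6 (λ x y u v a b →
    (x :+ y) :* a :+ (u :+ v) :* b := (x :* a :+ u :* b) :+ (y :* a :+ v :* b)) refl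

recurrence-backward : ∀ {f g} → FibonacciRecurrence f → FibonacciRecurrence g →
  ∀ c → f c ≡ g c → f (suc c) ≡ g (suc c) → f 0 ≡ g 0 × f 1 ≡ g 1
recurrence-backward recf recg zero f≡g f≡g′ = f≡g , f≡g′
recurrence-backward {f} {g} recf recg (suc c) f≡g f≡g′ =
  recurrence-backward {f} {g} recf recg c f≡g-c f≡g
  where
  f≡g-c : f c ≡ g c
  f≡g-c = +-cancelˡ-≡ (f (suc c)) (f c) (g c) (begin
    f (suc c) + f c    ≡⟨ recf c ⟨
    f (suc (suc c))    ≡⟨ f≡g′ ⟩
    g (suc (suc c))    ≡⟨ recg c ⟩
    g (suc c) + g c    ≡⟨ cong (_+ g c) f≡g ⟨
    f (suc c) + g c    ∎)
    where open ≡-Reasoning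

fibonacci-pair-solution : ∀ p e a b →
  h p * a + h (suc p) * b ≡ h (suc p + e) →
  h (suc p) * a + h (suc (suc p)) * b ≡ h (suc (suc p) + e) →
  a ≡ h e × b ≡ h (suc e)
fibonacci-pair-solution p e a b row₂≡ row₁≡ = a≡ , b≡
  where
  -- h 0 * a and h 1 * b normalise to 0 and b + 0
  initial : b + 0 ≡ h (suc e) × (a + 0) + (b + 0) ≡ h (suc e) + h e
  initial = recurrence-backward {λ c → h c * a + h (suc c) * b} {λ c → h (suc c + e)}
    (recurrence-linear {h} {h ∘ suc} h-recurrence (recurrence-suc {h} h-recurrence) a b)
    (recurrence-shift {h ∘ suc} (recurrence-suc {h} h-recurrence) e)
    p row₂≡ row₁≡
  b≡ : b ≡ h (suc e)
  b≡ = trans (sym (+-identityʳ b)) (proj₁ initial)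
  a≡ : a ≡ h e
  a≡ = +-cancelˡ-≡ b a (h e) (begin
    b + a                ≡⟨ +-comm b a ⟩
    a + b                ≡⟨ cong₂ _+_ (+-identityʳ a) (+-identityʳ b) ⟨
    (a + 0) + (b + 0)    ≡⟨ proj₂ initial ⟩
    h (suc e) + h e      ≡⟨ cong (_+ h e) b≡ ⟨
    b + h e              ∎)
    where open ≡-Reasoning

InV-supported-on-pair : ∀ {N} m e (z : Fin N → ℕ) (q₁ q₂ : Fin N) →
  toℕ q₁ ≡ m → toℕ q₂ ≡ suc m → (∀ q → q ≢ q₁ → q ≢ q₂ → z q ≡ 0) →
  InV (suc (suc m) + e) z → z q₁ ≡ h e × z q₂ ≡ h (suc e)
InV-supported-on-pair _ e z q₁ q₂ refl q₂≡ z≡0 (row₁≡ , row₂≡) =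
  fibonacci-pair-solution (toℕ q₁) e (z q₁) (z q₂)
    (trans (sym (weighted-sum h)) row₂≡)
    (trans (sym (weighted-sum (h ∘ suc))) row₁≡)
  where
  q₁≢q₂ : q₁ ≢ q₂
  q₁≢q₂ q₁≡q₂ = <⇒≢ (n<1+n (toℕ q₁)) (trans (cong toℕ q₁≡q₂) q₂≡)
  weighted-sum : (w : ℕ → ℕ) →
    sumFin (λ q → w (toℕ q) * z q) ≡ w (toℕ q₁) * z q₁ + w (suc (toℕ q₁)) * z q₂
  weighted-sum w =
    trans (sumFin-weighted-pair (w ∘ toℕ) z q₁ q₂ q₁≢q₂ z≡0)
          (cong (λ t → w (toℕ q₁) * z q₁ + w t * z q₂) q₂≡)

xvec-first : ∀ {N} n k (q : Fin N) → toℕ q + 3 ≡ k → xvec n k q ≡ h (n + 1 ∸ k)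
xvec-first n k q at with toℕ q + 3 ≟ k
... | yes _   = refl
... | no ¬at  = contradiction at ¬at

xvec-second : ∀ {N} n k (q : Fin N) → toℕ q + 2 ≡ k → xvec n k q ≡ h (n + 2 ∸ k)
xvec-second n k q at with toℕ q + 3 ≟ k
... | yes at′ = contradiction (+-cancelˡ-≡ (toℕ q) 3 2 (trans at′ (sym at))) λ ()
... | no _ with toℕ q + 2 ≟ k
...   | yes _  = refl
...   | no ¬at = contradiction at ¬at

xvec-outside : ∀ {N} n k (q : Fin N) → toℕ q + 3 ≢ k → toℕ q + 2 ≢ k → xvec n k q ≡ 0
xvec-outside n k q ¬at₁ ¬at₂ with toℕ q + 3 ≟ k
... | yes at₁ = contradiction at₁ ¬at₁
... | no _ with toℕ q + 2 ≟ k
...   | yes at₂ = contradiction at₂ ¬at₂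
...   | no _    = refl

supported-pair-≡-xvec : ∀ {N} m e (z : Fin N → ℕ) (q₁ q₂ : Fin N) →
  toℕ q₁ ≡ m → toℕ q₂ ≡ suc m → (∀ q → q ≢ q₁ → q ≢ q₂ → z q ≡ 0) →
  z q₁ ≡ h e → z q₂ ≡ h (suc e) →
  ∀ q → z q ≡ xvec (suc (suc m) + e) (suc (suc m) + 1) q
supported-pair-≡-xvec {N} m e z q₁ q₂ q₁≡ q₂≡ z≡0 z₁≡ z₂≡ = pointwise
  where
  j n k : ℕ
  j = suc (suc m)
  n = j + e
  k = j + 1
  at₁ : toℕ q₁ + 3 ≡ k
  at₁ = trans (cong (_+ 3) q₁≡) (trans (+-comm m 3) (+-comm 1 j))
  at₂ : toℕ q₂ + 2 ≡ k
  at₂ = trans (cong (_+ 2) q₂≡) (trans (+-comm (suc m) 2) (+-comm 1 j))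
  shift : ∀ c → n + c ∸ k ≡ e + c ∸ 1
  shift c = trans (cong (_∸ k) (+-assoc j e c)) ([m+n]∸[m+o]≡n∸o j (e + c) 1)
  first-value : n + 1 ∸ k ≡ e
  first-value = trans (shift 1) (m+n∸n≡m e 1)
  second-value : n + 2 ∸ k ≡ suc e
  second-value = trans (shift 2) (trans (cong (_∸ 1) (+-suc e 1)) (m+n∸n≡m (suc e) 1))
  same-index : ∀ (q q′ : Fin N) c → toℕ q + c ≡ k → toℕ q′ + c ≡ k → q ≡ q′
  same-index q q′ c at at′ = toℕ-injective (+-cancelʳ-≡ c (toℕ q) (toℕ q′) (trans at (sym at′)))
  pointwise : ∀ q → z q ≡ xvec n k q
  pointwise q with q ≟ᶠ q₁ | q ≟ᶠ q₂
  ... | yes refl | _ = begin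
    z q₁              ≡⟨ z₁≡ ⟩
    h e               ≡⟨ cong h first-value ⟨
    h (n + 1 ∸ k)     ≡⟨ xvec-first n k q₁ at₁ ⟨
    xvec n k q₁       ∎
    where open ≡-Reasoning
  ... | no _ | yes refl = begin
    z q₂              ≡⟨ z₂≡ ⟩
    h (suc e)         ≡⟨ cong h second-value ⟨
    h (n + 2 ∸ k)     ≡⟨ xvec-second n k q₂ at₂ ⟨
    xvec n k q₂       ∎
    where open ≡-Reasoning
  ... | no q≢q₁ | no q≢q₂ = trans (z≡0 q q≢q₁ q≢q₂) (sym (xvec-outside n k q
    (λ at → q≢q₁ (same-index q q₁ 3 at at₁)) (λ at → q≢q₂ (same-index q q₂ 2 at at₂))))

lemma6p1 : (N i : ℕ) → 1 ≤ i → i ≤ N → (z : Fin N → ℕ) → InV i z →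
    (j : ℕ) → 2 ≤ j → j ≤ i →
    (∀ (q : Fin N) → toℕ q + 1 ≢ j ∸ 1 → toℕ q + 1 ≢ j → z q ≡ 0) →
    (∀ (q : Fin N) → z q ≡ xvec i (j + 1) q) × InS i z
lemma6p1 N i _ i≤N z z∈V (suc (suc p)) (s≤s (s≤s _)) j≤i z≡0 with m≤n⇒∃[o]m+o≡n j≤i
... | e , refl = z≡x , (suc (suc p) + 1 , s≤s (s≤s (m≤n+m 1 p)) , +-monoˡ-≤ 1 j≤i , z≡x)
  where
  p+1<N : suc p < N
  p+1<N = ≤-trans j≤i i≤N
  q₁ q₂ : Fin N
  q₁ = fromℕ< (<-trans (n<1+n p) p+1<N)
  q₂ = fromℕ< p+1<N
  vanishes : ∀ q → q ≢ q₁ → q ≢ q₂ → z q ≡ 0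
  vanishes q q≢q₁ q≢q₂ = z≡0 q (avoids q≢q₁ (toℕ-fromℕ< _)) (avoids q≢q₂ (toℕ-fromℕ< _))
    where
    avoids : ∀ {q′ m} → q ≢ q′ → toℕ q′ ≡ m → toℕ q + 1 ≢ suc m
    avoids q≢q′ q′≡m at =
      q≢q′ (toℕ-injective (trans (suc-injective (trans (+-comm 1 (toℕ q)) at)) (sym q′≡m)))
  values : z q₁ ≡ h e × z q₂ ≡ h (suc e)
  values = InV-supported-on-pair p e z q₁ q₂ (toℕ-fromℕ< _) (toℕ-fromℕ< _) vanishes z∈V
  z≡x : ∀ q → z q ≡ xvec (suc (suc p) + e) (suc (suc p) + 1) q
  z≡x = supported-pair-≡-xvec p e z q₁ q₂ (toℕ-fromℕ< _) (toℕ-fromℕ< _) vanishes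
          (proj₁ values) (proj₂ values)
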